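{- Let $\mathsf{L}\in\{\mathsf{Int},\mathsf{Int}^\partial,\mathsf{Bi\text{ - }int}\}$, let $\mathcal{M}=(X,\leq,R,V)$ be an $\mathsf{L}_{\Box}$-model and set $R^+:=R\circ{\leq}$. Then $\mathcal{M}^+=(X,\leq,R^+,V)$ is a strictly condensed $\mathsf{L}_\Box$-model, and for all $x\in X$ and all $\phi\in\mathsf{L}_\Box$ we have $\mathcal{M},x\Vdash\phi$ iff $\mathcal{M}^+,x\Vdash\phi$.
   Context: $\mathsf{Bi\text{ - }int}$: $\phi::=\top\mid\bot\mid p\mid\phi\wedge\phi\mid\phi\vee\phi\mid\phi\to\phi\mid\phi\,{ -\!\!<}\,\phi$; $\mathsf{Int}$ and $\mathsf{Int}^\partial$ are the ${ -\!\!<}$-free and $\to$-free fragments; $\mathsf{L}_\Box$ adds a unary $\Box$ to $\mathsf{L}$. Write $x(Z\circ Z')y$ iff there is $u$ with $xZu$ and $uZ'y$. An $\mathsf{L}_\Box$-model is $(X,\leq,R,V)$ with $\leq$ a preorder on $X$, $R\subseteq X\times X$ with $({\leq}\circ R)\subseteq(R\circ{\leq})$, and $V$ mapping variables to upsets of $(X,\leq)$; it is strictly condensed if moreover $({\leq}\circ R\circ{\leq})\subseteq R$. Truth: $x\Vdash p$ iff $x\in V(p)$; $\top,\bot,\wedge,\vee$ as usual; $x\Vdash\phi\to\psi$ iff all $y\geq x$ with $y\Vdash\phi$ satisfy $\psi$; $x\Vdash\phi\,{ -\!\!<}\,\psi$ iff some $y\leq x$ has $y\Vdash\phi$, $y\not\Vdash\psi$;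 $x\Vdash\Box\phi$ iff all $y$ with $xRy$ satisfy $\phi$. -}

module Defs where

open import Level using (Level; _⊔_)
open import Data.Nat using (ℕ)
open import Data.Product using (Σ; ∃; _×_; _,_)
open import Data.Unit.Polymorphic using (⊤)
open import Data.Empty.Polymorphic using (⊥)
open import Data.Sum using (_⊎_)
open import Relation.Nullary using (¬_)
open import Relation.Binary using (Rel; IsPreorder)
open import Relation.Binary.PropositionalEquality using (_≡_)

data Form : Set where
  ⊤' ⊥' : Form
  var   : ℕ → Form
  _∧'_ _∨'_ _⇒'_ _-<'_ : Form → Form → Form
  □'    : Form → Form

data Logic : Set where
  Int IntDual BiInt : Logic

data InLang : Logic → Form → Set where
  top  : ∀ {L} → InLang L ⊤'
  bot  : ∀ {L} → InLang L ⊥'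
  atom : ∀ {L} n → InLang L (var n)
  conj : ∀ {L φ ψ} → InLang L φ → InLang L ψ → InLang L (φ ∧' ψ)
  disj : ∀ {L φ ψ} → InLang L φ → InLang L ψ → InLang L (φ ∨' ψ)
  impInt   : ∀ {φ ψ} → InLang Int φ → InLang Int ψ → InLang Int (φ ⇒' ψ)
  impBi    : ∀ {φ ψ} → InLang BiInt φ → InLang BiInt ψ → InLang BiInt (φ ⇒' ψ)
  coimpDual : ∀ {φ ψ} → InLang IntDual φ → InLang IntDual ψ → InLang IntDual (φ -<' ψ)
  coimpBi   : ∀ {φ ψ} → InLang BiInt φ → InLang BiInt ψ → InLang BiInt (φ -<' ψ)
  box  : ∀ {L φ} → InLang L φ → InLang L (□' φ)

_∘ᴿ_ : ∀ {a ℓ₁ ℓ₂} {X : Set a} → Rel X ℓ₁ → Rel X ℓ₂ → Rel X (a ⊔ ℓ₁ ⊔ ℓ₂)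
(Z ∘ᴿ Z') x y = ∃ λ u → Z x u × Z' u y

_⊆ᴿ_ : ∀ {a ℓ₁ ℓ₂} {X : Set a} → Rel X ℓ₁ → Rel X ℓ₂ → Set (a ⊔ ℓ₁ ⊔ ℓ₂)
Z ⊆ᴿ Z' = ∀ {x y} → Z x y → Z' x y

IsUpset : ∀ {a ℓ v} {X : Set a} → Rel X ℓ → (X → Set v) → Set (a ⊔ ℓ ⊔ v)
IsUpset _≤_ U = ∀ {x y} → x ≤ y → U x → U y

record IsModel {a ℓ r v} (X : Set a) (_≤_ : Rel X ℓ) (R : Rel X r)
               (V : ℕ → X → Set v) : Set (a ⊔ ℓ ⊔ r ⊔ v) where
  field
    preorder : IsPreorder _≡_ _≤_
    compat   : (_≤_ ∘ᴿ R) ⊆ᴿ (R ∘ᴿ _≤_)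
    upsets   : ∀ n → IsUpset _≤_ (V n)

record IsStrictlyCondensedModel {a ℓ r v} (X : Set a) (_≤_ : Rel X ℓ) (R : Rel X r)
               (V : ℕ → X → Set v) : Set (a ⊔ ℓ ⊔ r ⊔ v) where
  field
    model     : IsModel X _≤_ R V
    condensed : ((_≤_ ∘ᴿ R) ∘ᴿ _≤_) ⊆ᴿ R

Sat : ∀ {a ℓ r v} {X : Set a} (_≤_ : Rel X ℓ) (R : Rel X r) (V : ℕ → X → Set v) →
      X → Form → Set (a ⊔ ℓ ⊔ r ⊔ v)
Sat _≤_ R V x ⊤' = ⊤
Sat _≤_ R V x ⊥' = ⊥
Sat {a} {ℓ} {r} _≤_ R V x (var n) = Level.Lift (a ⊔ ℓ ⊔ r) (V n x)
Sat _≤_ R V x (φ ∧' ψ) = Sat _≤_ R V x φ × Sat _≤_ R V x ψ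
Sat _≤_ R V x (φ ∨' ψ) = Sat _≤_ R V x φ ⊎ Sat _≤_ R V x ψ
Sat _≤_ R V x (φ ⇒' ψ) = ∀ y → x ≤ y → Sat _≤_ R V y φ → Sat _≤_ R V y ψ
Sat _≤_ R V x (φ -<' ψ) = ∃ λ y → y ≤ x × Sat _≤_ R V y φ × ¬ Sat _≤_ R V y ψ
Sat _≤_ R V x (□' φ) = ∀ y → R x y → Sat _≤_ R V y φ

{-# OPTIONS --safe #-}
module Submission where

open import Defs
open import Data.Nat using (ℕ)
open import Data.Product using (_×_; _,_)
open import Data.Product.Function.NonDependent.Propositional using (_×-⇔_)
open import Data.Sum using (inj₁; inj₂)
open import Data.Sum.Function.Propositional using (_⊎-⇔_)
open import Function using (id)
open import Function.Bundles using (_⇔_; mk⇔; Equivalence)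
open import Function.Related.TypeIsomorphisms using (¬-cong-⇔)
open import Level using (lift)
open import Relation.Binary using (Rel; IsPreorder)

module _ {a ℓ r v} {X : Set a} {_≤_ : Rel X ℓ} {R : Rel X r} {V : ℕ → X → Set v}
         (M : IsModel X _≤_ R V) where

  open IsModel M
  open IsPreorder preorder using (trans) renaming (refl to ≤-refl)
  open Equivalence using (to; from)

  Sat-persistent : ∀ φ {x y} → x ≤ y → Sat _≤_ R V x φ → Sat _≤_ R V y φ
  Sat-persistent ⊤'       x≤y s                 = s
  Sat-persistent (var n)  x≤y (lift s)          = lift (upsets n x≤y s)
  Sat-persistent (φ ∧' ψ) x≤y (s , t)           = Sat-persistent φ x≤y s , Sat-persistent ψ x≤y t
  Sat-persistent (φ ∨' ψ) x≤y (inj₁ s)          = inj₁ (Sat-persistent φ x≤y s)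
  Sat-persistent (φ ∨' ψ) x≤y (inj₂ t)          = inj₂ (Sat-persistent ψ x≤y t)
  Sat-persistent (φ ⇒' ψ) x≤y s z y≤z           = s z (trans x≤y y≤z)
  Sat-persistent (φ -<' ψ) x≤y (z , z≤x , s , t) = z , trans z≤x x≤y , s , t
  Sat-persistent (□' φ)   x≤y s z yRz with compat (_ , x≤y , yRz)
  ... | w , xRw , w≤z = Sat-persistent φ w≤z (s w xRw)

  ∘≤-condensed : ((_≤_ ∘ᴿ (R ∘ᴿ _≤_)) ∘ᴿ _≤_) ⊆ᴿ (R ∘ᴿ _≤_)
  ∘≤-condensed (c , (b , x≤b , (d , bRd , d≤c)) , c≤y) with compat (_ , x≤b , bRd)
  ... | w , xRw , w≤d = w , xRw , trans w≤d (trans d≤c c≤y)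

  ∘≤-compat : (_≤_ ∘ᴿ (R ∘ᴿ _≤_)) ⊆ᴿ ((R ∘ᴿ _≤_) ∘ᴿ _≤_)
  ∘≤-compat x≤∘R∘≤y = _ , ∘≤-condensed (_ , x≤∘R∘≤y , ≤-refl) , ≤-refl

  ∘≤-isStrictlyCondensedModel : IsStrictlyCondensedModel X _≤_ (R ∘ᴿ _≤_) V
  ∘≤-isStrictlyCondensedModel = record
    { model     = record { preorder = preorder ; compat = ∘≤-compat ; upsets = upsets }
    ; condensed = ∘≤-condensed
    }

  -- Only the □ clause uses the hypotheses: an R'-successor lies above an R-successor,
  -- where the formula holds by persistence.
  Sat-⇔-between : ∀ {r′} {R′ : Rel X r′} → R ⊆ᴿ R′ → R′ ⊆ᴿ (R ∘ᴿ _≤_) →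
                  ∀ x φ → Sat _≤_ R V x φ ⇔ Sat _≤_ R′ V x φ
  Sat-⇔-between {R′ = R′} R⊆R′ R′⊆R∘≤ = go
    where
    go : ∀ x φ → Sat _≤_ R V x φ ⇔ Sat _≤_ R′ V x φ
    go x ⊤'        = mk⇔ _ _
    go x ⊥'        = mk⇔ (λ ()) (λ ())
    go x (var n)   = mk⇔ (λ { (lift s) → lift s }) (λ { (lift s) → lift s })
    go x (φ ∧' ψ)  = go x φ ×-⇔ go x ψ
    go x (φ ∨' ψ)  = go x φ ⊎-⇔ go x ψ
    go x (φ ⇒' ψ)  = mk⇔ (λ s y x≤y t → to (go y ψ) (s y x≤y (from (go y φ) t)))
                         (λ s y x≤y t → from (go y ψ) (s y x≤y (to (go y φ) t)))
    go x (φ -<' ψ) = mk⇔ (λ { (y , y≤x , s , t) → y , y≤x , to (φ∧¬ψ y) (s , t) })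
                         (λ { (y , y≤x , s , t) → y , y≤x , from (φ∧¬ψ y) (s , t) })
      where φ∧¬ψ = λ y → go y φ ×-⇔ ¬-cong-⇔ (go y ψ)
    go x (□' φ)    = mk⇔ (λ s y xR′y → forward s (R′⊆R∘≤ xR′y))
                         (λ s y xRy → from (go y φ) (s y (R⊆R′ xRy)))
      where
      forward : ∀ {y} → (∀ u → R x u → Sat _≤_ R V u φ) → (R ∘ᴿ _≤_) x y → Sat _≤_ R′ V y φ
      forward s (u , xRu , u≤y) = to (go _ φ) (Sat-persistent φ u≤y (s u xRu))

  Sat-⇔-∘≤ : ∀ x φ → Sat _≤_ R V x φ ⇔ Sat _≤_ (R ∘ᴿ _≤_) V x φ
  Sat-⇔-∘≤ = Sat-⇔-between (λ xRy → _ , xRy , ≤-refl) id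

proposition5p8 : ∀ {a ℓ r v} (L : Logic) (X : Set a) (_≤_ : Rel X ℓ) (R : Rel X r)
                   (V : ℕ → X → Set v) → IsModel X _≤_ R V →
                   IsStrictlyCondensedModel X _≤_ (R ∘ᴿ _≤_) V
                   × (∀ (x : X) (φ : Form) → InLang L φ →
                        (Sat _≤_ R V x φ ⇔ Sat _≤_ (R ∘ᴿ _≤_) V x φ))
proposition5p8 L X _≤_ R V M =
  ∘≤-isStrictlyCondensedModel M , λ x φ _ → Sat-⇔-∘≤ M x φ
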